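{- There exists an infinite family of tournaments such that each member of the family, having $n$ vertices, has exactly $21^{n/7}$ minimal feedback vertex sets.
   Context: A tournament $T=(V,A)$ is a directed graph with exactly one arc between every pair of distinct vertices. A feedback vertex set of $T$ is a set $F\subseteq V$ such that $T[V\setminus F]$ has no directed cycle; it is minimal if no proper subset of it is a feedback vertex set. -}

module Defs where

open import Data.Nat using (ℕ)
open import Data.Bool using (Bool; true; false)
open import Data.Fin using (Fin)
open import Data.Fin.Subset using (Subset; _∉_; _⊂_)
open import Data.List using (List; []; _∷_; _∷ʳ_)
open import Data.List.Relation.Unary.All using (All)
open import Data.List.Relation.Unary.Linked using (Linked)
open import Data.List.Relation.Unary.Unique.Propositional using (Unique)
open import Data.Product using (Σ; _×_)
open import Data.Sum using (_⊎_)
open import Relation.Binary.PropositionalEquality using (_≡_; _≢_)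
open import Relation.Nullary using (¬_)
open import Data.Empty using (⊥)

record Tournament (n : ℕ) : Set where
  field
    arc   : Fin n → Fin n → Bool
    irrefl : ∀ i → arc i i ≡ false
    total  : ∀ i j → i ≢ j → (arc i j ≡ true) ⊎ (arc j i ≡ true)
    asym   : ∀ i j → arc i j ≡ true → arc j i ≡ false

open Tournament public

_⟶[_]_ : ∀ {n} → Fin n → Tournament n → Fin n → Set
i ⟶[ T ] j = arc T i j ≡ true

-- A directed cycle of T avoiding F, i.e. a directed cycle of T[V ∖ F]:
-- a nonempty list of pairwise distinct vertices v₀ … vₖ, none in F,
-- with arcs v₀ → v₁ → … → vₖ → v₀.
CycleAvoiding : ∀ {n} → Tournament n → Subset n → List (Fin n) → Set
CycleAvoiding T F [] = ⊥
CycleAvoiding T F (v ∷ vs) =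
  Unique (v ∷ vs) × All (_∉ F) (v ∷ vs) × Linked (λ i j → i ⟶[ T ] j) ((v ∷ vs) ∷ʳ v)

IsFVS : ∀ {n} → Tournament n → Subset n → Set
IsFVS T F = ¬ (Σ (List _) (CycleAvoiding T F))

IsMinimalFVS : ∀ {n} → Tournament n → Subset n → Set
IsMinimalFVS T F = IsFVS T F × (∀ F′ → F′ ⊂ F → ¬ IsFVS T F′)

module Submission where

-- In a tournament every directed cycle avoiding F contains a directed triangle avoiding
-- F (a cycle v → w → x → ⋯ either closes as the triangle v w x or has the chord v → x).
-- Hence F is a feedback vertex set iff it meets every triangle, and F is a minimal one
-- iff for every vertex p
--     p ∈ F  ⇔  some triangle through p has its other two vertices outside F;
-- such a triangle is what stops F - p from being a feedback vertex set.
-- In T₁ ⊳ T₂ (copies of T₁ and T₂, every vertex of T₁ dominating every vertex of T₂)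
-- each triangle lies inside one block, so the minimal feedback vertex sets of T₁ ⊳ T₂
-- are exactly the sets F₁ ++ F₂ with Fᵢ minimal in Tᵢ, and the counts multiply.  The
-- Paley tournament on ℤ/7 has 21 minimal feedback vertex sets, found by evaluating the
-- decidable characterisation on all 128 vertex subsets; so k blocks of it form a
-- tournament on 7k vertices with exactly 21^k of them.

open import Defs
open import Data.Nat using (ℕ; _≤_; _*_; _^_)
open import Data.Fin.Subset using (Subset)
open import Data.List using (List; length)
open import Data.List.Membership.Propositional using (_∈_)
open import Data.List.Relation.Unary.Unique.Propositional using (Unique)
open import Data.Product using (Σ; _×_)
open import Function.Bundles using (_⇔_)
open import Relation.Binary.PropositionalEquality using (_≡_)

open import Data.Nat using (_+_; _∸_; _%_; zero; suc)
open import Data.Nat.Properties using (*-suc; *-zeroʳ; ≤-refl)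
open import Data.Bool using (Bool; true; false) renaming (_≟_ to _≟ᵇ_)
open import Data.Fin using (Fin; toℕ; splitAt; join; _↑ˡ_; _↑ʳ_) renaming (_≟_ to _≟ᶠ_)
open import Data.Fin.Properties
  using (any?; all?; splitAt-↑ˡ; splitAt-↑ʳ; splitAt⁻¹-↑ˡ; splitAt⁻¹-↑ʳ; join-splitAt)
open import Data.Fin.Subset using (_∉_; _⊆_; _-_) renaming (_∈_ to _∈ₛ_)
open import Data.Fin.Subset.Properties using (_∈?_; x∈p∧x≢y⇒x∈p-y; x∈p⇒p-x⊂p)
import Data.Vec as Vec
open import Data.Vec using (lookup; _++_)
open import Data.Vec.Properties
  using (lookup⇒[]=; []=⇒lookup; lookup-++ˡ; lookup-++ʳ; ++-injective; ∷-injective)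
open import Data.List using ([]; _∷_; _∷ʳ_; map; filter; cartesianProductWith)
open import Data.List.Properties using (length-++; length-map)
open import Data.List.Membership.Propositional.Properties
  using (∈-cartesianProductWith⁺; ∈-cartesianProductWith⁻; ∈-filter⁺; ∈-filter⁻)
open import Data.List.Relation.Unary.All using (All; []; _∷_)
open import Data.List.Relation.Unary.AllPairs using ([]; _∷_)
open import Data.List.Relation.Unary.Any using (here; there)
open import Data.List.Relation.Unary.Linked using (Linked; [-]; _∷_)
import Data.List.Relation.Unary.Unique.Propositional.Properties as Unique
open import Data.Product using (_,_; proj₂; ∃; ∃₂)
open import Data.Product.Function.NonDependent.Propositional using (_×-⇔_)
open import Data.Sum using (_⊎_; inj₁; inj₂; [_,_]′)
open import Data.Empty using (⊥-elim)
open import Function.Base using (_∘_)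
open import Function.Bundles using (mk⇔; Equivalence)
open import Function.Construct.Composition using (_⇔-∘_)
open import Function.Construct.Identity using (⇔-id)
open import Function.Construct.Symmetry using (⇔-sym)
open import Function.Related.TypeIsomorphisms using (¬-cong-⇔)
open import Relation.Binary.PropositionalEquality
  using (_≢_; refl; sym; trans; cong; cong₂; subst; module ≡-Reasoning)
open import Relation.Nullary using (¬_; Dec; yes; no; ¬?)
open import Relation.Nullary.Decidable
  using (_×-dec_; _⊎-dec_; _→-dec_; map′; from-yes; decidable-stable)
open import Relation.Unary using (Decidable)

open Equivalence using (to; from)

⇔-transport : ∀ {A A′ B B′ : Set} → A ⇔ A′ → B ⇔ B′ → A ⇔ B → A′ ⇔ B′
⇔-transport A⇔A′ B⇔B′ A⇔B = B⇔B′ ⇔-∘ (A⇔B ⇔-∘ ⇔-sym A⇔A′)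

_⇔?_ : ∀ {A B : Set} → Dec A → Dec B → Dec (A ⇔ B)
A? ⇔? B? = map′ (λ (f , g) → mk⇔ f g) (λ A⇔B → A⇔B .to , A⇔B .from)
                ((A? →-dec B?) ×-dec (B? →-dec A?))

∈-lookup : ∀ {m n} {P : Subset m} {Q : Subset n} {p q} →
           lookup P p ≡ lookup Q q → p ∈ₛ P ⇔ q ∈ₛ Q
∈-lookup {P = P} {Q} {p} {q} e = mk⇔
  (λ p∈P → lookup⇒[]= q Q (trans (sym e) ([]=⇒lookup p∈P)))
  (λ q∈Q → lookup⇒[]= p P (trans e ([]=⇒lookup q∈Q)))

module Triangles {n : ℕ} (T : Tournament n) where

  _⟶_ : Fin n → Fin n → Set
  p ⟶ q = p ⟶[ T ] q

  _⟶?_ : ∀ p q → Dec (p ⟶ q)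
  p ⟶? q = arc T p q ≟ᵇ true

  arc⇒≢ : ∀ {p q} → p ⟶ q → p ≢ q
  arc⇒≢ {p} pq refl with trans (sym pq) (irrefl T p)
  ... | ()

  no-2-cycle : ∀ {p q} → p ⟶ q → ¬ q ⟶ p
  no-2-cycle {p} {q} pq qp with trans (sym qp) (asym T p q pq)
  ... | ()

  reverse-arc : ∀ {p q} → p ≢ q → ¬ p ⟶ q → q ⟶ p
  reverse-arc {p} {q} p≢q ¬pq with total T p q p≢q
  ... | inj₁ pq = ⊥-elim (¬pq pq)
  ... | inj₂ qp = qp

  Triangle : Fin n → Fin n → Fin n → Set
  Triangle p q r = p ⟶ q × q ⟶ r × r ⟶ p

  rotate : ∀ {p q r} → Triangle p q r → Triangle q r p
  rotate (pq , qr , rp) = qr , rp , pq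

  -- A triangle through p whose two other vertices lie outside F.  For p ∉ F this is
  -- a triangle of T[V ∖ F]; for p ∈ F it is a triangle that only p covers.
  TriangleAt : Subset n → Fin n → Set
  TriangleAt F p = ∃₂ λ q r → Triangle p q r × q ∉ F × r ∉ F

  triangleAt? : ∀ F p → Dec (TriangleAt F p)
  triangleAt? F p = any? λ q → any? λ r →
    ((p ⟶? q) ×-dec (q ⟶? r) ×-dec (r ⟶? p)) ×-dec ¬? (q ∈? F) ×-dec ¬? (r ∈? F)

  TriangleAt-antitone : ∀ {F′ F p} → F′ ⊆ F → TriangleAt F p → TriangleAt F′ p
  TriangleAt-antitone F′⊆F (q , r , t , q∉F , r∉F) =
    q , r , t , (λ q∈F′ → q∉F (F′⊆F q∈F′)) , (λ r∈F′ → r∉F (F′⊆F r∈F′))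

  triangle⇒cycle : ∀ {F p} → p ∉ F → TriangleAt F p → Σ (List (Fin n)) (CycleAvoiding T F)
  triangle⇒cycle {p = p} p∉F (q , r , (pq , qr , rp) , q∉F , r∉F) =
    p ∷ q ∷ r ∷ [] ,
    ((arc⇒≢ pq ∷ (λ p≡r → arc⇒≢ rp (sym p≡r)) ∷ []) ∷ (arc⇒≢ qr ∷ []) ∷ [] ∷ []) ,
    (p∉F ∷ q∉F ∷ r∉F ∷ []) ,
    (pq ∷ qr ∷ rp ∷ [-])

  close-or-chord : ∀ {v w x} → v ⟶ w → w ⟶ x → x ⟶ v ⊎ v ⟶ x
  close-or-chord {v} {w} {x} vw wx with x ⟶? v
  ... | yes xv = inj₁ xv
  ... | no ¬xv = inj₂ (reverse-arc (λ { refl → no-2-cycle vw wx }) ¬xv)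

  -- Conversely every directed cycle v → w → x → ⋯ → v avoiding F contains a triangle
  -- avoiding F: either it closes as the triangle v w x, or the chord v → x gives a
  -- shorter cycle.
  cycle⇒triangle : ∀ {F} v vs → All (_∉ F) (v ∷ vs) → Linked _⟶_ ((v ∷ vs) ∷ʳ v) →
                   ∃ λ p → p ∉ F × TriangleAt F p
  cycle⇒triangle v [] _ (vv ∷ [-]) = ⊥-elim (arc⇒≢ vv refl)
  cycle⇒triangle v (w ∷ []) _ (vw ∷ wv ∷ [-]) = ⊥-elim (no-2-cycle vw wv)
  cycle⇒triangle v (w ∷ x ∷ rest) (v∉F ∷ w∉F ∷ x∉F ∷ rest∉F) (vw ∷ wx ∷ x⋯v) =
    [ (λ xv → v , v∉F , w , x , (vw , wx , xv) , w∉F , x∉F)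
    , (λ vx → cycle⇒triangle v (x ∷ rest) (v∉F ∷ x∉F ∷ rest∉F) (vx ∷ x⋯v))
    ]′ (close-or-chord vw wx)

  fvs⇔triangle-free : ∀ {F} → IsFVS T F ⇔ (∀ p → p ∉ F → ¬ TriangleAt F p)
  fvs⇔triangle-free = mk⇔
    (λ fvs p p∉F at → fvs (triangle⇒cycle p∉F at))
    (λ free → λ { ([] , ())
                ; (v ∷ vs , _ , v⋯∉F , v⋯v) → let p , p∉F , at = cycle⇒triangle v vs v⋯∉F v⋯v
                                               in free p p∉F at })

  TriangleMinimal : Subset n → Set
  TriangleMinimal F = ∀ p → p ∈ₛ F ⇔ TriangleAt F p

  triangleMinimal? : Decidable TriangleMinimal
  triangleMinimal? F = all? λ p → (p ∈? F) ⇔? triangleAt? F p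

  outside-removed : ∀ {F : Subset n} {p u : Fin n} → u ≢ p → u ∉ F - p → u ∉ F
  outside-removed u≢p u∉F-p u∈F = u∉F-p (x∈p∧x≢y⇒x∈p-y u∈F u≢p)

  -- A vertex w ∈ F missing from F - p is p itself, so a triangle w q r avoiding F - p
  -- is a triangle through p whose other two vertices avoid F.
  removed-vertex : ∀ {F : Subset n} {p w q r : Fin n} → w ∈ₛ F → w ∉ F - p → Triangle w q r →
                   q ∉ F - p → r ∉ F - p → TriangleAt F p
  removed-vertex {F} {p} {w} w∈F w∉F-p t@(wq , _ , rw) q∉F-p r∉F-p
    with decidable-stable (w ≟ᶠ p) (λ w≢p → outside-removed w≢p w∉F-p w∈F)
  ... | refl = _ , _ , t , outside-removed (λ q≡w → arc⇒≢ wq (sym q≡w)) q∉F-p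
                         , outside-removed (arc⇒≢ rw) r∉F-p

  triangle-after-removal : ∀ {F p v} → (∀ u → u ∉ F → ¬ TriangleAt F u) →
                           v ∉ F - p → TriangleAt (F - p) v → TriangleAt F p
  triangle-after-removal {F} {p} {v} free v∉F-p (q , r , t , q∉F-p , r∉F-p)
    with v ∈? F | q ∈? F | r ∈? F
  ... | yes v∈F | _       | _       = removed-vertex v∈F v∉F-p t q∉F-p r∉F-p
  ... | no _    | yes q∈F | _       = removed-vertex q∈F q∉F-p (rotate t) r∉F-p v∉F-p
  ... | no _    | no _    | yes r∈F = removed-vertex r∈F r∉F-p (rotate (rotate t)) v∉F-p q∉F-p
  ... | no v∉F  | no q∉F  | no r∉F  = ⊥-elim (free v v∉F (q , r , t , q∉F , r∉F))

  -- Minimality: a vertex p ∈ F without a triangle of its own could be removed, since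
  -- F - p would still meet every triangle; conversely, if every p ∈ F has one, every
  -- proper subset misses such a triangle entirely.
  minimal⇔triangle-minimal : ∀ {F} → IsMinimalFVS T F ⇔ TriangleMinimal F
  minimal⇔triangle-minimal {F} = mk⇔ minimal⇒ minimal⇐
    where
    minimal⇒ : IsMinimalFVS T F → TriangleMinimal F
    minimal⇒ (fvs , minimal) p = mk⇔ covered on-F
      where
      free = fvs⇔triangle-free .to fvs

      on-F : TriangleAt F p → p ∈ₛ F
      on-F at = decidable-stable (p ∈? F) (λ p∉F → free p p∉F at)

      covered : p ∈ₛ F → TriangleAt F p
      covered p∈F = decidable-stable (triangleAt? F p) λ ¬at →
        minimal (F - p) (x∈p⇒p-x⊂p p∈F) (fvs⇔triangle-free .from λ v v∉F-p at →
          ¬at (triangle-after-removal free v∉F-p at))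

    minimal⇐ : TriangleMinimal F → IsMinimalFVS T F
    minimal⇐ tmin = fvs⇔triangle-free .from (λ p p∉F at → p∉F (tmin p .from at)) ,
      λ { F′ (F′⊆F , x , x∈F , x∉F′) fvs′ →
            fvs⇔triangle-free .to fvs′ x x∉F′ (TriangleAt-antitone F′⊆F (tmin x .to x∈F)) }

open Triangles

module Blocks {a b : ℕ} where

  splitAt-injective : ∀ {p q : Fin (a + b)} → splitAt a p ≡ splitAt a q → p ≡ q
  splitAt-injective {p} {q} e = begin
    p                       ≡⟨ sym (join-splitAt a b p) ⟩
    join a b (splitAt a p)  ≡⟨ cong (join a b) e ⟩
    join a b (splitAt a q)  ≡⟨ join-splitAt a b q ⟩
    q                       ∎
    where open ≡-Reasoning

  data Side : Fin (a + b) → Set where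
    left  : ∀ x → Side (x ↑ˡ b)
    right : ∀ y → Side (a ↑ʳ y)

  side : ∀ p → Side p
  side p with splitAt a p in eq
  ... | inj₁ x = subst Side (splitAt⁻¹-↑ˡ eq) (left x)
  ... | inj₂ y = subst Side (splitAt⁻¹-↑ʳ eq) (right y)

  by-sides : ∀ {P : Fin (a + b) → Set} →
             (∀ x → P (x ↑ˡ b)) → (∀ y → P (a ↑ʳ y)) → ∀ p → P p
  by-sides onLeft onRight p with side p
  ... | left x  = onLeft x
  ... | right y = onRight y

  ∈-++ˡ : ∀ {F₁ : Subset a} {F₂ : Subset b} {x} → (x ↑ˡ b) ∈ₛ F₁ ++ F₂ ⇔ x ∈ₛ F₁
  ∈-++ˡ {F₁} {F₂} {x} = ∈-lookup (lookup-++ˡ F₁ F₂ x)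

  ∈-++ʳ : ∀ {F₁ : Subset a} {F₂ : Subset b} {y} → (a ↑ʳ y) ∈ₛ F₁ ++ F₂ ⇔ y ∈ₛ F₂
  ∈-++ʳ {F₁} {F₂} {y} = ∈-lookup (lookup-++ʳ F₁ F₂ y)

  ∉-++ˡ : ∀ {F₁ : Subset a} {F₂ : Subset b} {x} → (x ↑ˡ b) ∉ F₁ ++ F₂ ⇔ x ∉ F₁
  ∉-++ˡ = ¬-cong-⇔ ∈-++ˡ

  ∉-++ʳ : ∀ {F₁ : Subset a} {F₂ : Subset b} {y} → (a ↑ʳ y) ∉ F₁ ++ F₂ ⇔ y ∉ F₂
  ∉-++ʳ = ¬-cong-⇔ ∈-++ʳ

module _ {a b : ℕ} (T₁ : Tournament a) (T₂ : Tournament b) where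

  open Blocks {a} {b}

  blockArc : Fin a ⊎ Fin b → Fin a ⊎ Fin b → Bool
  blockArc (inj₁ x) (inj₁ y) = arc T₁ x y
  blockArc (inj₁ x) (inj₂ y) = true
  blockArc (inj₂ x) (inj₁ y) = false
  blockArc (inj₂ x) (inj₂ y) = arc T₂ x y

  blockArc-irrefl : ∀ s → blockArc s s ≡ false
  blockArc-irrefl (inj₁ x) = irrefl T₁ x
  blockArc-irrefl (inj₂ y) = irrefl T₂ y

  blockArc-total : ∀ s t → s ≢ t → blockArc s t ≡ true ⊎ blockArc t s ≡ true
  blockArc-total (inj₁ x) (inj₁ y) s≢t = total T₁ x y (s≢t ∘ cong inj₁)
  blockArc-total (inj₁ x) (inj₂ y) _   = inj₁ refl
  blockArc-total (inj₂ x) (inj₁ y) _   = inj₂ refl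
  blockArc-total (inj₂ x) (inj₂ y) s≢t = total T₂ x y (s≢t ∘ cong inj₂)

  blockArc-asym : ∀ s t → blockArc s t ≡ true → blockArc t s ≡ false
  blockArc-asym (inj₁ x) (inj₁ y) = asym T₁ x y
  blockArc-asym (inj₁ x) (inj₂ y) _ = refl
  blockArc-asym (inj₂ x) (inj₂ y) = asym T₂ x y

  infixr 5 _⊳_
  _⊳_ : Tournament (a + b)
  _⊳_ = record
    { arc    = λ p q → blockArc (splitAt a p) (splitAt a q)
    ; irrefl = λ p → blockArc-irrefl (splitAt a p)
    ; total  = λ p q p≢q → blockArc-total (splitAt a p) (splitAt a q) (p≢q ∘ splitAt-injective)
    ; asym   = λ p q → blockArc-asym (splitAt a p) (splitAt a q)
    }

-- Every triangle of T₁ ⊳ T₂ lies inside one block, since no arc leads from the right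
-- block back to the left one.
module Composite {a b : ℕ} (T₁ : Tournament a) (T₂ : Tournament b) where

  open Blocks {a} {b}

  ≡true-cong : ∀ {s t : Bool} → s ≡ t → (s ≡ true) ⇔ (t ≡ true)
  ≡true-cong refl = ⇔-id _

  ⟶-ˡ : ∀ {x y} → (x ↑ˡ b) ⟶[ T₁ ⊳ T₂ ] (y ↑ˡ b) ⇔ x ⟶[ T₁ ] y
  ⟶-ˡ {x} {y} = ≡true-cong (cong₂ (blockArc T₁ T₂) (splitAt-↑ˡ a x b) (splitAt-↑ˡ a y b))

  ⟶-ʳ : ∀ {x y} → (a ↑ʳ x) ⟶[ T₁ ⊳ T₂ ] (a ↑ʳ y) ⇔ x ⟶[ T₂ ] y
  ⟶-ʳ {x} {y} = ≡true-cong (cong₂ (blockArc T₁ T₂) (splitAt-↑ʳ a b x) (splitAt-↑ʳ a b y))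

  no-arc-ʳˡ : ∀ {y x} → ¬ (a ↑ʳ y) ⟶[ T₁ ⊳ T₂ ] (x ↑ˡ b)
  no-arc-ʳˡ {y} {x} yx
    with trans (sym yx) (cong₂ (blockArc T₁ T₂) (splitAt-↑ʳ a b y) (splitAt-↑ˡ a x b))
  ... | ()

  triangle-ˡ : ∀ {x y z} → Triangle (T₁ ⊳ T₂) (x ↑ˡ b) (y ↑ˡ b) (z ↑ˡ b) ⇔ Triangle T₁ x y z
  triangle-ˡ = ⟶-ˡ ×-⇔ ⟶-ˡ ×-⇔ ⟶-ˡ

  triangle-ʳ : ∀ {x y z} → Triangle (T₁ ⊳ T₂) (a ↑ʳ x) (a ↑ʳ y) (a ↑ʳ z) ⇔ Triangle T₂ x y z
  triangle-ʳ = ⟶-ʳ ×-⇔ ⟶-ʳ ×-⇔ ⟶-ʳ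

  module _ {F₁ : Subset a} {F₂ : Subset b} where

    -- A triangle through a left vertex stays in the left block, since leaving it would
    -- need an arc back from the right block; symmetrically for the right block.
    at-⊳ˡ : ∀ {x} → TriangleAt (T₁ ⊳ T₂) (F₁ ++ F₂) (x ↑ˡ b) ⇔ TriangleAt T₁ F₁ x
    at-⊳ˡ {x} = mk⇔ lower lift
      where
      lower : TriangleAt (T₁ ⊳ T₂) (F₁ ++ F₂) (x ↑ˡ b) → TriangleAt T₁ F₁ x
      lower (q , r , t@(_ , qr , rx) , q∉F , r∉F) with side q | side r
      ... | left y  | left z  = y , z , triangle-ˡ .to t , ∉-++ˡ .to q∉F , ∉-++ˡ .to r∉F
      ... | left _  | right _ = ⊥-elim (no-arc-ʳˡ rx)
      ... | right _ | left _  = ⊥-elim (no-arc-ʳˡ qr)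
      ... | right _ | right _ = ⊥-elim (no-arc-ʳˡ rx)

      lift : TriangleAt T₁ F₁ x → TriangleAt (T₁ ⊳ T₂) (F₁ ++ F₂) (x ↑ˡ b)
      lift (y , z , t , y∉F₁ , z∉F₁) =
        y ↑ˡ b , z ↑ˡ b , triangle-ˡ .from t , ∉-++ˡ .from y∉F₁ , ∉-++ˡ .from z∉F₁

    at-⊳ʳ : ∀ {x} → TriangleAt (T₁ ⊳ T₂) (F₁ ++ F₂) (a ↑ʳ x) ⇔ TriangleAt T₂ F₂ x
    at-⊳ʳ {x} = mk⇔ lower lift
      where
      lower : TriangleAt (T₁ ⊳ T₂) (F₁ ++ F₂) (a ↑ʳ x) → TriangleAt T₂ F₂ x
      lower (q , r , t@(xq , qr , _) , q∉F , r∉F) with side q | side r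
      ... | left _  | _       = ⊥-elim (no-arc-ʳˡ xq)
      ... | right _ | left _  = ⊥-elim (no-arc-ʳˡ qr)
      ... | right y | right z = y , z , triangle-ʳ .to t , ∉-++ʳ .to q∉F , ∉-++ʳ .to r∉F

      lift : TriangleAt T₂ F₂ x → TriangleAt (T₁ ⊳ T₂) (F₁ ++ F₂) (a ↑ʳ x)
      lift (y , z , t , y∉F₂ , z∉F₂) =
        a ↑ʳ y , a ↑ʳ z , triangle-ʳ .from t , ∉-++ʳ .from y∉F₂ , ∉-++ʳ .from z∉F₂

    triangle-minimal-⊳ : TriangleMinimal (T₁ ⊳ T₂) (F₁ ++ F₂) ⇔
                         (TriangleMinimal T₁ F₁ × TriangleMinimal T₂ F₂)
    triangle-minimal-⊳ = mk⇔
      (λ min → (λ x → ⇔-transport ∈-++ˡ at-⊳ˡ (min (x ↑ˡ b)))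
             , (λ y → ⇔-transport ∈-++ʳ at-⊳ʳ (min (a ↑ʳ y))))
      (λ (min₁ , min₂) → by-sides
        (λ x → ⇔-transport (⇔-sym ∈-++ˡ) (⇔-sym at-⊳ˡ) (min₁ x))
        (λ y → ⇔-transport (⇔-sym ∈-++ʳ) (⇔-sym at-⊳ʳ) (min₂ y)))

    minimal-⊳ : IsMinimalFVS (T₁ ⊳ T₂) (F₁ ++ F₂) ⇔ (IsMinimalFVS T₁ F₁ × IsMinimalFVS T₂ F₂)
    minimal-⊳ = (⇔-sym (minimal⇔triangle-minimal T₁) ×-⇔ ⇔-sym (minimal⇔triangle-minimal T₂))
                ⇔-∘ (triangle-minimal-⊳ ⇔-∘ minimal⇔triangle-minimal (T₁ ⊳ T₂))

Enumeration : ∀ {n} → (Subset n → Set) → ℕ → Set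
Enumeration {n} P c =
  Σ (List (Subset n)) λ Fs → Unique Fs × (∀ F → (F ∈ Fs) ⇔ P F) × length Fs ≡ c

enumeration-⇔ : ∀ {n} {P Q : Subset n → Set} {c} →
                (∀ F → P F ⇔ Q F) → Enumeration P c → Enumeration Q c
enumeration-⇔ P⇔Q (Fs , unique , members , len) = Fs , unique , (λ F → P⇔Q F ⇔-∘ members F) , len

allSubsets : ∀ n → List (Subset n)
allSubsets zero    = Vec.[] ∷ []
allSubsets (suc n) = cartesianProductWith Vec._∷_ (true ∷ false ∷ []) (allSubsets n)

allSubsets-complete : ∀ {n} (F : Subset n) → F ∈ allSubsets n
allSubsets-complete Vec.[]          = here refl
allSubsets-complete (s Vec.∷ F) = ∈-cartesianProductWith⁺ Vec._∷_ (bit s) (allSubsets-complete F)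
  where
  bit : ∀ s → s ∈ true ∷ false ∷ []
  bit true  = here refl
  bit false = there (here refl)

allSubsets-unique : ∀ n → Unique (allSubsets n)
allSubsets-unique zero    = [] ∷ []
allSubsets-unique (suc n) =
  Unique.cartesianProductWith⁺ Vec._∷_ ∷-injective (((λ ()) ∷ []) ∷ [] ∷ []) (allSubsets-unique n)

enumerate : ∀ {n} {P : Subset n → Set} (P? : Decidable P) →
            Enumeration P (length (filter P? (allSubsets n)))
enumerate {n} P? =
  filter P? (allSubsets n) ,
  Unique.filter⁺ P? (allSubsets-unique n) ,
  (λ F → mk⇔ (proj₂ ∘ ∈-filter⁻ P? {xs = allSubsets n}) (∈-filter⁺ P? (allSubsets-complete F))) ,
  refl

length-cartesianProductWith : ∀ {A B C : Set} (f : A → B → C) xs ys →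
  length (cartesianProductWith f xs ys) ≡ length xs * length ys
length-cartesianProductWith f []       ys = refl
length-cartesianProductWith f (x ∷ xs) ys =
  trans (length-++ (map (f x) ys))
        (cong₂ _+_ (length-map (f x) ys) (length-cartesianProductWith f xs ys))

enumeration-++ : ∀ {a b c d} {P : Subset a → Set} {Q : Subset b → Set} {R : Subset (a + b) → Set} →
                 (∀ F₁ F₂ → R (F₁ ++ F₂) ⇔ (P F₁ × Q F₂)) →
                 Enumeration P c → Enumeration Q d → Enumeration R (c * d)
enumeration-++ {a} {R = R} R⇔ (Fs , uniqueF , membersF , lenF) (Gs , uniqueG , membersG , lenG) =
  cartesianProductWith _++_ Fs Gs ,
  Unique.cartesianProductWith⁺ _++_ (++-injective _ _) uniqueF uniqueG ,
  members ,
  trans (length-cartesianProductWith _++_ Fs Gs) (cong₂ _*_ lenF lenG)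
  where
  members : ∀ F → (F ∈ cartesianProductWith _++_ Fs Gs) ⇔ R F
  members F with Vec.splitAt a F
  ... | F₁ , F₂ , refl = mk⇔ listed⇒R R⇒listed
    where
    listed⇒R : F₁ ++ F₂ ∈ cartesianProductWith _++_ Fs Gs → R (F₁ ++ F₂)
    listed⇒R h with ∈-cartesianProductWith⁻ _++_ Fs Gs h
    ... | G₁ , G₂ , G₁∈Fs , G₂∈Gs , eq =
      subst R (sym eq) (R⇔ G₁ G₂ .from (membersF G₁ .to G₁∈Fs , membersG G₂ .to G₂∈Gs))

    R⇒listed : R (F₁ ++ F₂) → F₁ ++ F₂ ∈ cartesianProductWith _++_ Fs Gs
    R⇒listed r with R⇔ F₁ F₂ .to r
    ... | p , q = ∈-cartesianProductWith⁺ _++_ (membersF F₁ .from p) (membersG F₂ .from q)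

minimalFVSs : ∀ {n} (T : Tournament n) →
              Enumeration (IsMinimalFVS T) (length (filter (triangleMinimal? T) (allSubsets n)))
minimalFVSs T =
  enumeration-⇔ (λ F → ⇔-sym (minimal⇔triangle-minimal T)) (enumerate (triangleMinimal? T))

MinimalFVSCount : ℕ → ℕ → Set
MinimalFVSCount n c = Σ (Tournament n) λ T → Enumeration (IsMinimalFVS T) c

empty-count : MinimalFVSCount 0 1
empty-count = empty , minimalFVSs empty
  where
  empty : Tournament 0
  empty = record { arc = λ () ; irrefl = λ () ; total = λ () ; asym = λ () }

⊳-count : ∀ {a b c d} → MinimalFVSCount a c → MinimalFVSCount b d →
          MinimalFVSCount (a + b) (c * d)
⊳-count (T₁ , enum₁) (T₂ , enum₂) =
  T₁ ⊳ T₂ , enumeration-++ (λ F₁ F₂ → Composite.minimal-⊳ T₁ T₂) enum₁ enum₂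

power-count : ∀ {n c} → MinimalFVSCount n c → ∀ k → MinimalFVSCount (n * k) (c ^ k)
power-count {n} _    zero    = subst (λ m → MinimalFVSCount m 1) (sym (*-zeroʳ n)) empty-count
power-count {n} {c} base (suc k) =
  subst (λ m → MinimalFVSCount m (c ^ suc k)) (sym (*-suc n k)) (⊳-count base (power-count base k))

isQR₇ : ℕ → Bool
isQR₇ 1 = true
isQR₇ 2 = true
isQR₇ 4 = true
isQR₇ _ = false

paleyArc : Fin 7 → Fin 7 → Bool
paleyArc i j = isQR₇ ((7 + toℕ j ∸ toℕ i) % 7)

-- The Paley tournament on ℤ/7; as -1 is not a square modulo 7, exactly one of i → j and
-- j → i holds for i ≠ j.  The tournament axioms are checked by evaluation.
paley₇ : Tournament 7
paley₇ = record
  { arc    = paleyArc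
  ; irrefl = from-yes (all? λ i → paleyArc i i ≟ᵇ false)
  ; total  = from-yes (all? λ i → all? λ j →
               ¬? (i ≟ᶠ j) →-dec ((paleyArc i j ≟ᵇ true) ⊎-dec (paleyArc j i ≟ᵇ true)))
  ; asym   = from-yes (all? λ i → all? λ j →
               (paleyArc i j ≟ᵇ true) →-dec (paleyArc j i ≟ᵇ false))
  }

paley₇-count : MinimalFVSCount 7 21
paley₇-count = paley₇ , minimalFVSs paley₇

lemma2 : (m : ℕ) →
    Σ ℕ λ k → m ≤ k × Σ (Tournament (7 * k)) λ T →
      Σ (List (Subset (7 * k))) λ Fs →
        Unique Fs × (∀ F → (F ∈ Fs) ⇔ IsMinimalFVS T F) × length Fs ≡ 21 ^ k
lemma2 m = m , ≤-refl , power-count paley₇-count m
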